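{- Let $\mathcal{Q}$ be a finite poset. Then the space of relations $\mathfrak{R}_\mathcal{Q}^\star$ of $\mathsf{As}(\mathcal{Q})$ satisfies $\dim\mathfrak{R}_\mathcal{Q}^\star=4\,\mathrm{int}(\mathcal{Q})-3\,\#\mathcal{Q}$.
   Context: Operads are nonsymmetric over a field of characteristic zero. For comparable $a,b$ in $\mathcal{Q}$, $a\uparrow_\mathcal{Q} b:=\min(a,b)$. $\mathsf{As}(\mathcal{Q})$ is the operad with binary generators $\star_a$, $a\in\mathcal{Q}$, and space of relations $\mathfrak{R}_\mathcal{Q}^\star$ (a subspace of the arity-3 part of the free operad on these generators) spanned by $\star_a\circ_1\star_b-\star_{a\uparrow b}\circ_2\star_{a\uparrow b}$ and $\star_{a\uparrow b}\circ_1\star_{a\uparrow b}-\star_a\circ_2\star_b$ for all comparable $a,b\in\mathcal{Q}$ (including $a=b$). $\mathrm{int}(\mathcal{Q})$ is the number of intervals of $\mathcal{Q}$, i.e. the number of pairs $(a,c)$ with $a\preccurlyeq_\mathcal{Q} c$. -}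

module Defs where

open import Level using (Level; _⊔_) renaming (suc to lsuc)
open import Data.Nat as ℕ using (ℕ; zero; suc)
open import Data.Fin using (Fin; zero; suc)
open import Data.Fin.Properties using () renaming (_≟_ to _≟F_)
open import Data.Product using (Σ; ∃; _×_; _,_)
open import Data.Sum using (_⊎_)
open import Relation.Nullary using (¬_; Dec; yes; no)
open import Relation.Binary.PropositionalEquality using (_≡_)
open import Relation.Binary.Structures using (IsDecPartialOrder)
open import Algebra.Bundles using (CommutativeRing)

record Field (c ℓ : Level) : Set (lsuc (c ⊔ ℓ)) where
  field
    commutativeRing : CommutativeRing c ℓ
  open CommutativeRing commutativeRing public
  field
    0≉1     : ¬ (0# ≈ 1#)
    inverse : ∀ x → ¬ (x ≈ 0#) → ∃ λ y → x * y ≈ 1#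

  natK : ℕ → Carrier
  natK zero    = 0#
  natK (suc n) = 1# + natK n

record CharZeroField (c ℓ : Level) : Set (lsuc (c ⊔ ℓ)) where
  field
    field′    : Field c ℓ
  open Field field′ public
  field
    charZero : ∀ n → ¬ (natK (suc n) ≈ 0#)

record FinPoset : Set₁ where
  field
    size      : ℕ
    _≼_       : Fin size → Fin size → Set
    isDecPO   : IsDecPartialOrder _≡_ _≼_
  open IsDecPartialOrder isDecPO public using (_≤?_)

module _ (Q : FinPoset) where
  open FinPoset Q

  -- a ↑ b := min(a,b) (meaningful for comparable a, b)
  _↑_ : Fin size → Fin size → Fin size
  a ↑ b with a ≤? b
  ... | yes _ = a
  ... | no  _ = b

  Comparable : Fin size → Fin size → Set
  Comparable a b = (a ≼ b) ⊎ (b ≼ a)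

  comparable? : ∀ a b → Dec (Comparable a b)
  comparable? a b with a ≤? b | b ≤? a
  ... | yes p | _     = yes (_⊎_.inj₁ p)
  ... | no _  | yes q = yes (_⊎_.inj₂ q)
  ... | no ¬p | no ¬q = no λ { (_⊎_.inj₁ p) → ¬p p ; (_⊎_.inj₂ q) → ¬q q }

sumℕ : ∀ {k} → (Fin k → ℕ) → ℕ
sumℕ {zero}  f = 0
sumℕ {suc k} f = f zero ℕ.+ sumℕ (λ i → f (suc i))

int : FinPoset → ℕ
int Q = sumℕ λ a → sumℕ λ c → indicator (a ≤? c)
  where
    open FinPoset Q
    indicator : ∀ {P : Set} → Dec P → ℕ
    indicator (yes _) = 1
    indicator (no _)  = 0

module LinAlg {c ℓ} (K : CharZeroField c ℓ) where
  open CharZeroField K using (Carrier; _≈_; _+_; _*_; _-_; 0#; 1#)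

  ΣK : ∀ {k} → (Fin k → Carrier) → Carrier
  ΣK {zero}  f = 0#
  ΣK {suc k} f = f zero + ΣK (λ i → f (suc i))

  -- Arity-3 component of the free nonsymmetric operad on binary generators
  -- ⋆_a (a ∈ Fin n): basis  ⋆_x ∘_t ⋆_y  with t ∈ {∘₁ = zero, ∘₂ = suc zero}
  Idx : ℕ → Set
  Idx n = Fin 2 × Fin n × Fin n

  V : ℕ → Set c
  V n = Idx n → Carrier

  ΣIdx : ∀ {n} → (Idx n → Carrier) → Carrier
  ΣIdx f = ΣK λ t → ΣK λ x → ΣK λ y → f (t , x , y)

  basis : ∀ {n} → Fin 2 → Fin n → Fin n → V n
  basis t x y (t′ , x′ , y′) with t ≟F t′ | x ≟F x′ | y ≟F y′
  ... | yes _ | yes _ | yes _ = 1#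
  ... | _     | _     | _     = 0#

  _−V_ : ∀ {n} → V n → V n → V n
  (u −V v) i = u i - v i

  0V : ∀ {n} → V n
  0V _ = 0#

  lincomb : ∀ {n k} → (Fin k → Carrier) → (Fin k → V n) → V n
  lincomb coef b i = ΣK λ j → coef j * b j i

  HasDim : ∀ {n ℓ′} → (V n → Set ℓ′) → ℕ → Set (c ⊔ ℓ ⊔ ℓ′)
  HasDim {n} W d = Σ (Fin d → V n) λ b →
      (∀ j → W (b j))
    × (∀ coef → (∀ i → lincomb coef b i ≈ 0#) → ∀ j → coef j ≈ 0#)
    × (∀ v → W v → ∃ λ coef → ∀ i → v i ≈ lincomb coef b i)

  module _ (Q : FinPoset) where
    open FinPoset Q

    -- the generators of 𝔑^⋆_Q, indexed by (t , a , b):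
    --  t = ∘₁-type: ⋆_a ∘₁ ⋆_b − ⋆_{a↑b} ∘₂ ⋆_{a↑b}
    --  t = ∘₂-type: ⋆_{a↑b} ∘₁ ⋆_{a↑b} − ⋆_a ∘₂ ⋆_b
    -- for comparable a, b; the zero vector for incomparable a, b
    -- (which does not change the span).
    ∘₁ ∘₂ : Fin 2
    ∘₁ = zero
    ∘₂ = suc zero

    relGen : Idx size → V size
    relGen (t , a , b) with comparable? Q a b
    relGen (zero , a , b) | yes _ =
      basis ∘₁ a b −V basis ∘₂ (_↑_ Q a b) (_↑_ Q a b)
    relGen (suc _ , a , b) | yes _ =
      basis ∘₁ (_↑_ Q a b) (_↑_ Q a b) −V basis ∘₂ a b
    relGen (t , a , b) | no _ = 0V

    RelSpace : V size → Set (c ⊔ ℓ)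
    RelSpace v = ∃ λ (coef : Idx size → Carrier) →
      ∀ i → v i ≈ ΣIdx (λ g → coef g * relGen g i)

module Submission where

open import Defs
open import Level using (Level; 0ℓ; _⊔_)
open import Data.Bool.Base using (if_then_else_)
open import Data.Nat as ℕ using (ℕ; zero; suc; _∸_)
import Data.Nat.Properties as ℕₚ
open import Data.Nat.Tactic.RingSolver using (solve-∀)
open import Data.Fin using (Fin; zero; suc; _↑ˡ_; _↑ʳ_; splitAt)
open import Data.Fin.Patterns using (0F; 1F)
open import Data.Fin.Properties
  using (splitAt-↑ˡ; splitAt-↑ʳ; splitAt⁻¹-↑ˡ; splitAt⁻¹-↑ʳ; suc-injective) renaming (_≟_ to _≟F_)
open import Data.Product as Product using (Σ; ∃; _×_; _,_; proj₁; proj₂)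
open import Data.Product.Properties using (≡-dec)
open import Data.Sum using (inj₁; inj₂; [_,_]′)
open import Data.Empty using (⊥-elim)
open import Function using (_∘_; id)
open import Relation.Nullary using (¬_; Dec; yes; no; does)
open import Relation.Nullary.Decidable using (_×-dec_; ¬?; dec-true; dec-false)
open import Relation.Unary using (Pred; Decidable)
open import Relation.Binary.PropositionalEquality as ≡ using (_≡_; _≢_; refl; cong)
open import Relation.Binary.Structures using (IsDecPartialOrder)
import Algebra.Properties.Semiring.Sum as SemiringSum
import Algebra.Properties.Ring as RingProperties
open SemiringSum ℕₚ.+-*-semiring
  using () renaming (sum to ∑ℕ; ∑-distrib-+ to ∑ℕ-distrib-+; ∑-comm to ∑ℕ-comm)

-- For a = b the two relations indexed by (a, b) coincide (both are ⋆_a ∘₁ ⋆_a − ⋆_a ∘₂ ⋆_a),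
-- and for incomparable a, b the generator is zero.  The remaining generators — the
-- ∘₁-relations for the 2 int(Q) − #Q comparable pairs and the ∘₂-relations for the
-- 2 int(Q) − 2 #Q comparable pairs with a ≠ b — form a basis.  A generator indexed by
-- (t, a, b) with a ≠ b is the only one with a nonzero coordinate at (t, a, b), because the
-- second term of every generator sits at a diagonal index (t′, m, m); once their coefficients
-- vanish, the diagonal generators are separated by the coordinates (∘₁, a, a).

𝟙 : ∀ {p} {A : Set p} → Dec A → ℕ
𝟙 d = if does d then 1 else 0

sumℕ≡∑ : ∀ {k} (f : Fin k → ℕ) → sumℕ f ≡ ∑ℕ f
sumℕ≡∑ {zero}  f = refl
sumℕ≡∑ {suc k} f = cong (f zero ℕ.+_) (sumℕ≡∑ (f ∘ suc))

sumℕ-cong : ∀ {k} {f g : Fin k → ℕ} → (∀ i → f i ≡ g i) → sumℕ f ≡ sumℕ g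
sumℕ-cong {zero}  f≡g = refl
sumℕ-cong {suc k} f≡g = ≡.cong₂ ℕ._+_ (f≡g zero) (sumℕ-cong (f≡g ∘ suc))

sumℕ-+ : ∀ {k} (f g : Fin k → ℕ) → sumℕ (λ i → f i ℕ.+ g i) ≡ sumℕ f ℕ.+ sumℕ g
sumℕ-+ f g = begin
  sumℕ (λ i → f i ℕ.+ g i) ≡⟨ sumℕ≡∑ (λ i → f i ℕ.+ g i) ⟩
  ∑ℕ (λ i → f i ℕ.+ g i)   ≡⟨ ∑ℕ-distrib-+ f g ⟩
  ∑ℕ f ℕ.+ ∑ℕ g            ≡⟨ ≡.cong₂ ℕ._+_ (sumℕ≡∑ f) (sumℕ≡∑ g) ⟨
  sumℕ f ℕ.+ sumℕ g        ∎
  where open ≡.≡-Reasoning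

sumℕ-*ˡ : ∀ {k} m (f : Fin k → ℕ) → sumℕ (λ i → m ℕ.* f i) ≡ m ℕ.* sumℕ f
sumℕ-*ˡ {zero}  m f = ≡.sym (ℕₚ.*-zeroʳ m)
sumℕ-*ˡ {suc k} m f =
  ≡.trans (cong (m ℕ.* f zero ℕ.+_) (sumℕ-*ˡ m (f ∘ suc))) (≡.sym (ℕₚ.*-distribˡ-+ m _ _))

sumℕ-comm : ∀ {k l} (f : Fin k → Fin l → ℕ) →
            sumℕ (λ i → sumℕ (f i)) ≡ sumℕ (λ j → sumℕ (λ i → f i j))
sumℕ-comm f = begin
  sumℕ (λ i → sumℕ (f i))         ≡⟨ sumℕ-cong (λ i → sumℕ≡∑ (f i)) ⟩
  sumℕ (λ i → ∑ℕ (f i))           ≡⟨ sumℕ≡∑ (λ i → ∑ℕ (f i)) ⟩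
  ∑ℕ (λ i → ∑ℕ (f i))             ≡⟨ ∑ℕ-comm f ⟩
  ∑ℕ (λ j → ∑ℕ (λ i → f i j))     ≡⟨ sumℕ≡∑ (λ j → ∑ℕ (λ i → f i j)) ⟨
  sumℕ (λ j → ∑ℕ (λ i → f i j))   ≡⟨ sumℕ-cong (λ j → sumℕ≡∑ (λ i → f i j)) ⟨
  sumℕ (λ j → sumℕ (λ i → f i j)) ∎
  where open ≡.≡-Reasoning

sumℕ-const : ∀ k m → sumℕ {k} (λ _ → m) ≡ k ℕ.* m
sumℕ-const zero    m = refl
sumℕ-const (suc k) m = cong (m ℕ.+_) (sumℕ-const k m)

sumℕ-𝟙-≟ : ∀ {k} (a : Fin k) → sumℕ (λ b → 𝟙 (a ≟F b)) ≡ 1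
sumℕ-𝟙-≟ {suc k} zero    = cong suc (≡.trans (sumℕ-const k 0) (ℕₚ.*-zeroʳ k))
sumℕ-𝟙-≟ {suc k} (suc a) = sumℕ-𝟙-≟ a

joinΣ : ∀ {k} (f : Fin k → ℕ) → Σ (Fin k) (Fin ∘ f) → Fin (sumℕ f)
joinΣ f (zero  , y) = y ↑ˡ _
joinΣ f (suc x , y) = f zero ↑ʳ joinΣ (f ∘ suc) (x , y)

splitΣ : ∀ {k} (f : Fin k → ℕ) → Fin (sumℕ f) → Σ (Fin k) (Fin ∘ f)
splitΣ {suc k} f j =
  [ (zero ,_) , Product.map suc id ∘ splitΣ (f ∘ suc) ]′ (splitAt (f zero) j)

splitΣ-joinΣ : ∀ {k} (f : Fin k → ℕ) p → splitΣ f (joinΣ f p) ≡ p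
splitΣ-joinΣ f (zero , y) rewrite splitAt-↑ˡ (f zero) y (sumℕ (f ∘ suc)) = refl
splitΣ-joinΣ f (suc x , y)
  rewrite splitAt-↑ʳ (f zero) (sumℕ (f ∘ suc)) (joinΣ (f ∘ suc) (x , y))
        | splitΣ-joinΣ (f ∘ suc) (x , y) = refl

joinΣ-splitΣ : ∀ {k} (f : Fin k → ℕ) j → joinΣ f (splitΣ f j) ≡ j
joinΣ-splitΣ {suc k} f j with splitAt (f zero) j in eq
... | inj₁ y = splitAt⁻¹-↑ˡ eq
... | inj₂ z = ≡.trans (cong (f zero ↑ʳ_) (joinΣ-splitΣ (f ∘ suc) z)) (splitAt⁻¹-↑ʳ eq)

module Fin-sum³ {n} (f : Fin 2 × Fin n × Fin n → ℕ) where
  curry₃ : Fin 2 → Fin n → Fin n → ℕ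
  curry₃ t a b = f (t , a , b)

  ∑ᵇ : Fin 2 → Fin n → ℕ
  ∑ᵇ t a = sumℕ (curry₃ t a)

  ∑ᵃᵇ : Fin 2 → ℕ
  ∑ᵃᵇ t = sumℕ (∑ᵇ t)

  sum³ : ℕ
  sum³ = sumℕ ∑ᵃᵇ

  join³ : Σ _ (Fin ∘ f) → Fin sum³
  join³ ((t , a , b) , w) = joinΣ ∑ᵃᵇ (t , joinΣ (∑ᵇ t) (a , joinΣ (curry₃ t a) (b , w)))

  split³ : Fin sum³ → Σ _ (Fin ∘ f)
  split³ j =
    let (t , j₁) = splitΣ ∑ᵃᵇ j
        (a , j₂) = splitΣ (∑ᵇ t) j₁
        (b , w)  = splitΣ (curry₃ t a) j₂
    in (t , a , b) , w

  split³-join³ : ∀ p → split³ (join³ p) ≡ p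
  split³-join³ ((t , a , b) , w)
    rewrite splitΣ-joinΣ ∑ᵃᵇ (t , joinΣ (∑ᵇ t) (a , joinΣ (curry₃ t a) (b , w)))
          | splitΣ-joinΣ (∑ᵇ t) (a , joinΣ (curry₃ t a) (b , w))
          | splitΣ-joinΣ (curry₃ t a) (b , w) = refl

  join³-split³ : ∀ j → join³ (split³ j) ≡ j
  join³-split³ j =
    let (t , j₁) = splitΣ ∑ᵃᵇ j
        (a , j₂) = splitΣ (∑ᵇ t) j₁
    in begin
      joinΣ ∑ᵃᵇ (t , joinΣ (∑ᵇ t) (a , joinΣ (curry₃ t a) (splitΣ (curry₃ t a) j₂)))
        ≡⟨ cong (λ x → joinΣ ∑ᵃᵇ (t , joinΣ (∑ᵇ t) (a , x))) (joinΣ-splitΣ (curry₃ t a) j₂) ⟩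
      joinΣ ∑ᵃᵇ (t , joinΣ (∑ᵇ t) (splitΣ (∑ᵇ t) j₁))
        ≡⟨ cong (λ x → joinΣ ∑ᵃᵇ (t , x)) (joinΣ-splitΣ (∑ᵇ t) j₁) ⟩
      joinΣ ∑ᵃᵇ (splitΣ ∑ᵃᵇ j)
        ≡⟨ joinΣ-splitΣ ∑ᵃᵇ j ⟩
      j ∎
    where open ≡.≡-Reasoning

open Fin-sum³ using (sum³; join³; split³; split³-join³; join³-split³)

module _ (Q : FinPoset) where
  open FinPoset Q
  open IsDecPartialOrder isDecPO using (antisym) renaming (refl to ≼-refl)
  open import Data.Nat using (_+_; _*_)

  Good : Pred (Fin 2 × Fin size × Fin size) 0ℓ
  Good (0F , a , b) = Comparable Q a b
  Good (1F , a , b) = Comparable Q a b × a ≢ b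

  good? : Decidable Good
  good? (0F , a , b) = comparable? Q a b
  good? (1F , a , b) = comparable? Q a b ×-dec ¬? (a ≟F b)

  good⇒comparable : ∀ t {a b} → Good (t , a , b) → Comparable Q a b
  good⇒comparable 0F = id
  good⇒comparable 1F = proj₁

  ↑-idem : ∀ a → _↑_ Q a a ≡ a
  ↑-idem a with a ≤? a
  ... | yes _ = refl
  ... | no _  = refl

  𝟙-good : ∀ a b → 𝟙 (good? (0F , a , b)) + 𝟙 (good? (1F , a , b)) + 3 * 𝟙 (a ≟F b)
                   ≡ 2 * (𝟙 (a ≤? b) + 𝟙 (b ≤? a))
  𝟙-good a b with a ≟F b
  ... | yes refl rewrite dec-true (comparable? Q a a) (inj₁ ≼-refl) | dec-true (a ≤? a) ≼-refl = refl
  ... | no a≢b with a ≤? b | b ≤? a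
  ...   | yes a≼b | yes b≼a = ⊥-elim (a≢b (antisym a≼b b≼a))
  ...   | yes _   | no _    = refl
  ...   | no _    | yes _   = refl
  ...   | no _    | no _    = refl

  ΣΣ : (Fin size → Fin size → ℕ) → ℕ
  ΣΣ f = sumℕ λ a → sumℕ (f a)

  ΣΣ-+ : ∀ f g → ΣΣ (λ a b → f a b + g a b) ≡ ΣΣ f + ΣΣ g
  ΣΣ-+ f g =
    ≡.trans (sumℕ-cong λ a → sumℕ-+ (f a) (g a)) (sumℕ-+ (λ a → sumℕ (f a)) (λ a → sumℕ (g a)))

  ΣΣ-*ˡ : ∀ m f → ΣΣ (λ a b → m * f a b) ≡ m * ΣΣ f
  ΣΣ-*ˡ m f = ≡.trans (sumℕ-cong λ a → sumℕ-*ˡ m (f a)) (sumℕ-*ˡ m (λ a → sumℕ (f a)))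

  ΣΣ-𝟙-≟ : ΣΣ (λ a b → 𝟙 (a ≟F b)) ≡ size
  ΣΣ-𝟙-≟ =
    ≡.trans (sumℕ-cong {size} sumℕ-𝟙-≟) (≡.trans (sumℕ-const size 1) (ℕₚ.*-identityʳ size))

  -- Defs.int counts with an indicator that is local to its where block, so the left-hand
  -- side of int-summand can only be written by inference.
  mutual
    int≡ΣΣ : int Q ≡ ΣΣ λ a b → 𝟙 (a ≤? b)
    int≡ΣΣ = sumℕ-cong λ a → sumℕ-cong λ b → int-summand a b

    int-summand : ∀ a b → _ ≡ 𝟙 (a ≤? b)
    int-summand a b with a ≤? b
    ... | yes _ = refl
    ... | no _  = refl

  count-good : sum³ (λ i → 𝟙 (good? i)) + 3 * size ≡ 4 * int Q
  count-good = begin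
    G 0F + (G 1F + 0) + 3 * size
      ≡⟨ cong (λ x → G 0F + x + 3 * size) (ℕₚ.+-identityʳ (G 1F)) ⟩
    G 0F + G 1F + 3 * size
      ≡⟨ cong (λ x → G 0F + G 1F + 3 * x) ΣΣ-𝟙-≟ ⟨
    G 0F + G 1F + 3 * ΣΣ δ
      ≡⟨ ≡.cong₂ _+_ (ΣΣ-+ (g 0F) (g 1F)) (ΣΣ-*ˡ 3 δ) ⟨
    ΣΣ (λ a b → g 0F a b + g 1F a b) + ΣΣ (λ a b → 3 * δ a b)
      ≡⟨ ΣΣ-+ (λ a b → g 0F a b + g 1F a b) (λ a b → 3 * δ a b) ⟨
    ΣΣ (λ a b → g 0F a b + g 1F a b + 3 * δ a b)
      ≡⟨ sumℕ-cong (λ a → sumℕ-cong (𝟙-good a)) ⟩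
    ΣΣ (λ a b → 2 * (le a b + le b a))
      ≡⟨ ΣΣ-*ˡ 2 (λ a b → le a b + le b a) ⟩
    2 * ΣΣ (λ a b → le a b + le b a)
      ≡⟨ cong (2 *_) (ΣΣ-+ le (λ a b → le b a)) ⟩
    2 * (ΣΣ le + ΣΣ (λ a b → le b a))
      ≡⟨ cong (λ x → 2 * (ΣΣ le + x)) (sumℕ-comm λ a b → le b a) ⟩
    2 * (ΣΣ le + ΣΣ le)
      ≡⟨ 2*[m+m]≡4*m (ΣΣ le) ⟩
    4 * ΣΣ le
      ≡⟨ cong (4 *_) int≡ΣΣ ⟨
    4 * int Q ∎
    where
    open ≡.≡-Reasoning
    g : Fin 2 → Fin size → Fin size → ℕ
    g t a b = 𝟙 (good? (t , a , b))
    G : Fin 2 → ℕ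
    G t = ΣΣ (g t)
    δ le : Fin size → Fin size → ℕ
    δ a b = 𝟙 (a ≟F b)
    le a b = 𝟙 (a ≤? b)
    2*[m+m]≡4*m : ∀ m → 2 * (m + m) ≡ 4 * m
    2*[m+m]≡4*m = solve-∀

module _ {c ℓ} (K : CharZeroField c ℓ) where
  open CharZeroField K hiding (zero) renaming (refl to ≈-refl)
  open LinAlg K
  open SemiringSum semiring using (sum; ∑-distrib-+; *-distribʳ-sum)
  open RingProperties ring using (-1*x≈-x; -‿involutive; -0#≈0#)
  open import Relation.Binary.Reasoning.Setoid setoid

  ΣK≡sum : ∀ {k} (f : Fin k → Carrier) → ΣK f ≡ sum f
  ΣK≡sum {zero}  f = refl
  ΣK≡sum {suc k} f = cong (f zero +_) (ΣK≡sum (f ∘ suc))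

  ΣK-cong : ∀ {k} {f g : Fin k → Carrier} → (∀ i → f i ≈ g i) → ΣK f ≈ ΣK g
  ΣK-cong {zero}  f≈g = ≈-refl
  ΣK-cong {suc k} f≈g = +-cong (f≈g zero) (ΣK-cong (f≈g ∘ suc))

  ΣK-zero : ∀ {k} {f : Fin k → Carrier} → (∀ i → f i ≈ 0#) → ΣK f ≈ 0#
  ΣK-zero {zero}  f≈0 = ≈-refl
  ΣK-zero {suc k} f≈0 = trans (+-cong (f≈0 zero) (ΣK-zero (f≈0 ∘ suc))) (+-identityˡ 0#)

  ΣK-single : ∀ {k} (f : Fin k → Carrier) i → (∀ j → j ≢ i → f j ≈ 0#) → ΣK f ≈ f i
  ΣK-single f zero    others =
    trans (+-congˡ (ΣK-zero λ j → others (suc j) λ ())) (+-identityʳ _)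
  ΣK-single f (suc i) others =
    trans (+-congʳ (others zero λ ())) (trans (+-identityˡ _)
      (ΣK-single (f ∘ suc) i λ j j≢i → others (suc j) (j≢i ∘ suc-injective)))

  ΣK-+ : ∀ {k} (f g : Fin k → Carrier) → ΣK (λ i → f i + g i) ≈ ΣK f + ΣK g
  ΣK-+ f g = begin
    ΣK (λ i → f i + g i)  ≡⟨ ΣK≡sum (λ i → f i + g i) ⟩
    sum (λ i → f i + g i) ≈⟨ ∑-distrib-+ f g ⟩
    sum f + sum g         ≡⟨ ≡.cong₂ _+_ (ΣK≡sum f) (ΣK≡sum g) ⟨
    ΣK f + ΣK g           ∎

  ΣK-*ʳ : ∀ {k} (f : Fin k → Carrier) x → ΣK f * x ≈ ΣK (λ i → f i * x)
  ΣK-*ʳ f x = begin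
    ΣK f * x            ≡⟨ cong (_* x) (ΣK≡sum f) ⟩
    sum f * x           ≈⟨ *-distribʳ-sum x f ⟩
    sum (λ i → f i * x) ≡⟨ ΣK≡sum (λ i → f i * x) ⟨
    ΣK (λ i → f i * x)  ∎

  ΣK-splitAt : ∀ m {n} (h : Fin (m ℕ.+ n) → Carrier) →
               ΣK h ≈ ΣK (λ i → h (i ↑ˡ n)) + ΣK (λ i → h (m ↑ʳ i))
  ΣK-splitAt zero    h = sym (+-identityˡ _)
  ΣK-splitAt (suc m) h = trans (+-congˡ (ΣK-splitAt m (h ∘ suc))) (sym (+-assoc _ _ _))

  ΣK-joinΣ : ∀ {k} (f : Fin k → ℕ) (h : Fin (sumℕ f) → Carrier) →
             ΣK h ≈ ΣK λ x → ΣK λ y → h (joinΣ f (x , y))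
  ΣK-joinΣ {zero}  f h = ≈-refl
  ΣK-joinΣ {suc k} f h =
    trans (ΣK-splitAt (f zero) h) (+-congˡ (ΣK-joinΣ (f ∘ suc) (h ∘ (f zero ↑ʳ_))))

  ΣK-𝟙-no : ∀ {p} {A : Set p} (d : Dec A) → ¬ A → (h : Fin (𝟙 d) → Carrier) → ΣK h ≈ 0#
  ΣK-𝟙-no (yes a) ¬a h = ⊥-elim (¬a a)
  ΣK-𝟙-no (no _)  ¬a h = ≈-refl

  ΣK-𝟙-at : ∀ {p} {A : Set p} (d : Dec A) (h : Fin (𝟙 d) → Carrier) w → ΣK h ≈ h w
  ΣK-𝟙-at (yes _) h zero = +-identityʳ _

  ΣK-𝟙-const : ∀ {p} {A : Set p} (d : Dec A) {x} → (¬ A → x ≈ 0#) → ΣK {𝟙 d} (λ _ → x) ≈ x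
  ΣK-𝟙-const (yes _) x≈0 = +-identityʳ _
  ΣK-𝟙-const (no ¬a) x≈0 = sym (x≈0 ¬a)

  ΣK-join³ : ∀ {n} (f : Idx n → ℕ) (h : Fin (sum³ f) → Carrier) →
             ΣK h ≈ ΣIdx λ i → ΣK λ w → h (join³ f (i , w))
  ΣK-join³ f h =
    trans (ΣK-joinΣ ∑ᵃᵇ h) (ΣK-cong λ t →
      trans (ΣK-joinΣ (∑ᵇ t) (λ y → h (joinΣ ∑ᵃᵇ (t , y)))) (ΣK-cong λ a →
        ΣK-joinΣ (curry₃ t a) (λ z → h (joinΣ ∑ᵃᵇ (t , joinΣ (∑ᵇ t) (a , z))))))
    where open Fin-sum³ f using (curry₃; ∑ᵇ; ∑ᵃᵇ)

  ΣIdx-cong : ∀ {n} {f g : Idx n → Carrier} → (∀ i → f i ≈ g i) → ΣIdx f ≈ ΣIdx g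
  ΣIdx-cong f≈g = ΣK-cong λ t → ΣK-cong λ a → ΣK-cong λ b → f≈g (t , a , b)

  ΣIdx-single : ∀ {n} (f : Idx n → Carrier) i → (∀ j → j ≢ i → f j ≈ 0#) → ΣIdx f ≈ f i
  ΣIdx-single f (t , a , b) others = begin
    ΣIdx f
      ≈⟨ ΣK-single _ t (λ t′ t′≢t → ΣK-zero λ a′ → ΣK-zero λ b′ →
           others (t′ , a′ , b′) (t′≢t ∘ cong proj₁)) ⟩
    ΣK (λ a′ → ΣK λ b′ → f (t , a′ , b′))
      ≈⟨ ΣK-single _ a (λ a′ a′≢a → ΣK-zero λ b′ →
           others (t , a′ , b′) (a′≢a ∘ cong (proj₁ ∘ proj₂))) ⟩
    ΣK (λ b′ → f (t , a , b′))
      ≈⟨ ΣK-single _ b (λ b′ b′≢b → others (t , a , b′) (b′≢b ∘ cong (proj₂ ∘ proj₂))) ⟩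
    f (t , a , b) ∎

  ΣIdx-pair : ∀ {n} (f : Idx n → Carrier) →
              ΣIdx f ≈ ΣK λ a → ΣK λ b → f (0F , a , b) + f (1F , a , b)
  ΣIdx-pair f = begin
    ΣIdx f
      ≈⟨ +-congˡ (+-identityʳ _) ⟩
    ΣK (λ a → ΣK (f₀ a)) + ΣK (λ a → ΣK (f₁ a))
      ≈⟨ ΣK-+ (λ a → ΣK (f₀ a)) (λ a → ΣK (f₁ a)) ⟨
    ΣK (λ a → ΣK (f₀ a) + ΣK (f₁ a))
      ≈⟨ ΣK-cong (λ a → ΣK-+ (f₀ a) (f₁ a)) ⟨
    ΣK (λ a → ΣK λ b → f₀ a b + f₁ a b) ∎
    where
    f₀ f₁ : Fin _ → Fin _ → Carrier
    f₀ a b = f (0F , a , b)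
    f₁ a b = f (1F , a , b)

  lincombIdx : ∀ {n} → (Idx n → Carrier) → (Idx n → V n) → V n
  lincombIdx coef gen k = ΣIdx λ i → coef i * gen i k

  Span : ∀ {n} → (Idx n → V n) → V n → Set (c ⊔ ℓ)
  Span gen v = ∃ λ coef → ∀ k → v k ≈ lincombIdx coef gen k

  SupportedOn : ∀ {n p} → Pred (Idx n) p → (Idx n → Carrier) → Set (p ⊔ ℓ)
  SupportedOn P coef = ∀ i → ¬ P i → coef i ≈ 0#

  _≟ᴵ_ : ∀ {n} (i j : Idx n) → Dec (i ≡ j)
  _≟ᴵ_ = ≡-dec _≟F_ (≡-dec _≟F_ _≟F_)

  gen∈Span : ∀ {n} (gen : Idx n → V n) i → Span gen (gen i)
  gen∈Span gen i = δ , λ k → sym (begin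
    lincombIdx δ gen k ≈⟨ ΣIdx-single (λ j → δ j * gen j k) i (δ-others k) ⟩
    δ i * gen i k      ≈⟨ *-congʳ δ-self ⟩
    1# * gen i k       ≈⟨ *-identityˡ _ ⟩
    gen i k            ∎)
    where
    δ : Idx _ → Carrier
    δ j = if does (j ≟ᴵ i) then 1# else 0#

    δ-self : δ i ≈ 1#
    δ-self rewrite dec-true (i ≟ᴵ i) refl = ≈-refl

    δ-others : ∀ k j → j ≢ i → δ j * gen j k ≈ 0#
    δ-others k j j≢i rewrite dec-false (j ≟ᴵ i) j≢i = zeroˡ _

  -- The basis is gen restricted to P, enumerated through
  -- Fin (sum³ (𝟙 ∘ P?)) ≅ Σ i , Fin (𝟙 (P? i)) by join³ and split³.
  module _ {n p} {P : Pred (Idx n) p} (P? : Decidable P) (gen : Idx n → V n) where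
    private
      selection : Idx n → ℕ
      selection i = 𝟙 (P? i)

      selected : Fin (sum³ selection) → Idx n
      selected = proj₁ ∘ split³ selection

      selected-join³ : ∀ i w → selected (join³ selection (i , w)) ≡ i
      selected-join³ i w = cong proj₁ (split³-join³ selection (i , w))

      lincomb-selected : ∀ coef k → lincomb coef (gen ∘ selected) k ≈
                         ΣIdx λ i → ΣK λ w → coef (join³ selection (i , w)) * gen i k
      lincomb-selected coef k =
        trans (ΣK-join³ selection (λ j → coef j * gen (selected j) k))
              (ΣIdx-cong λ i → ΣK-cong λ w →
                reflexive (cong (λ x → coef (join³ selection (i , w)) * gen x k) (selected-join³ i w)))

    hasDim-Span :
      (∀ coef → ∃ λ coef′ → SupportedOn P coef′ × (∀ k → lincombIdx coef gen k ≈ lincombIdx coef′ gen k)) →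
      (∀ coef → SupportedOn P coef → (∀ k → lincombIdx coef gen k ≈ 0#) → ∀ i → coef i ≈ 0#) →
      HasDim (Span gen) (sum³ selection)
    hasDim-Span reduce independent =
      gen ∘ selected , gen∈Span gen ∘ selected , linearlyIndependent , spanning
      where
      linearlyIndependent : ∀ coef → (∀ k → lincomb coef (gen ∘ selected) k ≈ 0#) → ∀ j → coef j ≈ 0#
      linearlyIndependent coef comb≈0 j = begin
        coef j                                      ≡⟨ cong coef (join³-split³ selection j) ⟨
        coef (join³ selection (split³ selection j)) ≈⟨ ΣK-𝟙-at (P? (selected j)) _ _ ⟨
        collected (selected j)                      ≈⟨ independent collected supported combination (selected j) ⟩
        0#                                          ∎
        where
        collected : Idx n → Carrier
        collected i = ΣK λ w → coef (join³ selection (i , w))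

        supported : SupportedOn P collected
        supported i ¬Pi = ΣK-𝟙-no (P? i) ¬Pi _

        combination : ∀ k → lincombIdx collected gen k ≈ 0#
        combination k = begin
          lincombIdx collected gen k
            ≈⟨ ΣIdx-cong (λ i → ΣK-*ʳ (λ w → coef (join³ selection (i , w))) (gen i k)) ⟩
          ΣIdx (λ i → ΣK λ w → coef (join³ selection (i , w)) * gen i k)
            ≈⟨ lincomb-selected coef k ⟨
          lincomb coef (gen ∘ selected) k
            ≈⟨ comb≈0 k ⟩
          0# ∎

      spanning : ∀ v → Span gen v → ∃ λ coef → ∀ k → v k ≈ lincomb coef (gen ∘ selected) k
      spanning v (coef , v≈) with reduce coef
      ... | coef′ , supported , same = coef′ ∘ selected , λ k → begin
        v k
          ≈⟨ v≈ k ⟩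
        lincombIdx coef gen k
          ≈⟨ same k ⟩
        lincombIdx coef′ gen k
          ≈⟨ ΣIdx-cong (λ i → ΣK-𝟙-const (P? i) λ ¬Pi →
               trans (*-congʳ (supported i ¬Pi)) (zeroˡ (gen i k))) ⟨
        ΣIdx (λ i → ΣK {selection i} λ _ → coef′ i * gen i k)
          ≈⟨ ΣIdx-cong (λ i → ΣK-cong λ w →
               reflexive (cong (λ x → coef′ x * gen i k) (selected-join³ i w))) ⟨
        ΣIdx (λ i → ΣK λ w → coef′ (selected (join³ selection (i , w))) * gen i k)
          ≈⟨ lincomb-selected (coef′ ∘ selected) k ⟨
        lincomb (coef′ ∘ selected) (gen ∘ selected) k ∎

  basis-self : ∀ {n} t (x y : Fin n) → basis t x y (t , x , y) ≡ 1#
  basis-self t x y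
    rewrite ≡.≡-≟-identity _≟F_ {t} refl
          | ≡.≡-≟-identity _≟F_ {x} refl
          | ≡.≡-≟-identity _≟F_ {y} refl = refl

  basis-other : ∀ {n} t (x y : Fin n) k → (t , x , y) ≢ k → basis t x y k ≡ 0#
  basis-other t x y (t′ , x′ , y′) ≢k with t ≟F t′ | x ≟F x′ | y ≟F y′
  ... | yes refl | yes refl | yes refl = ⊥-elim (≢k refl)
  ... | no _     | _        | _        = refl
  ... | yes _    | no _     | _        = refl
  ... | yes _    | yes _    | no _     = refl

  sign : Fin 2 → Carrier
  sign 0F = 1#
  sign 1F = - 1#

  sign*sign≈1 : ∀ t → sign t * sign t ≈ 1#
  sign*sign≈1 0F = *-identityˡ 1#
  sign*sign≈1 1F = trans (-1*x≈-x (- 1#)) (-‿involutive 1#)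

  cancel-sign : ∀ t {x} → x * sign t ≈ 0# → x ≈ 0#
  cancel-sign t {x} x*s≈0 = begin
    x                     ≈⟨ *-identityʳ x ⟨
    x * 1#                ≈⟨ *-congˡ (sign*sign≈1 t) ⟨
    x * (sign t * sign t) ≈⟨ *-assoc x (sign t) (sign t) ⟨
    x * sign t * sign t   ≈⟨ *-congʳ x*s≈0 ⟩
    0# * sign t           ≈⟨ zeroˡ (sign t) ⟩
    0#                    ∎

  module _ (Q : FinPoset) where
    open FinPoset Q
    open IsDecPartialOrder isDecPO using () renaming (refl to ≼-refl)

    diagonal≢ : ∀ {t t′ : Fin 2} {a b} (m : Fin size) → a ≢ b → (t′ , m , m) ≢ (t , a , b)
    diagonal≢ m a≢b refl = a≢b refl

    relGen-self : ∀ t {a b} → Comparable Q a b → relGen Q (t , a , b) (t , a , b) ≈ sign t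
    relGen-self t {a} {b} cmp with comparable? Q a b
    ... | no ¬cmp = ⊥-elim (¬cmp cmp)
    relGen-self 0F {a} {b} cmp | yes _
      rewrite basis-self 0F a b | basis-other 1F (_↑_ Q a b) (_↑_ Q a b) (0F , a , b) (λ ())
      = trans (+-congˡ -0#≈0#) (+-identityʳ 1#)
    relGen-self 1F {a} {b} cmp | yes _
      rewrite basis-self 1F a b | basis-other 0F (_↑_ Q a b) (_↑_ Q a b) (1F , a , b) (λ ())
      = +-identityˡ (- 1#)

    relGen-offDiagonal : ∀ {t a b} j → a ≢ b → j ≢ (t , a , b) → relGen Q j (t , a , b) ≈ 0#
    relGen-offDiagonal (t′ , a′ , b′) a≢b j≢ with comparable? Q a′ b′
    ... | no _ = ≈-refl
    relGen-offDiagonal {t} {a} {b} (0F , a′ , b′) a≢b j≢ | yes _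
      rewrite basis-other 0F a′ b′ (t , a , b) j≢
            | basis-other 1F (_↑_ Q a′ b′) (_↑_ Q a′ b′) (t , a , b) (diagonal≢ (_↑_ Q a′ b′) a≢b)
      = -‿inverseʳ 0#
    relGen-offDiagonal {t} {a} {b} (1F , a′ , b′) a≢b j≢ | yes _
      rewrite basis-other 0F (_↑_ Q a′ b′) (_↑_ Q a′ b′) (t , a , b) (diagonal≢ (_↑_ Q a′ b′) a≢b)
            | basis-other 1F a′ b′ (t , a , b) j≢
      = -‿inverseʳ 0#

    relGen-diagonal : ∀ {a′ a} → a′ ≢ a → relGen Q (0F , a′ , a′) (0F , a , a) ≈ 0#
    relGen-diagonal {a′} {a} a′≢a with comparable? Q a′ a′
    ... | no _ = ≈-refl
    ... | yes _
      rewrite basis-other 0F a′ a′ (0F , a , a) (a′≢a ∘ cong (proj₁ ∘ proj₂))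
            | basis-other 1F (_↑_ Q a′ a′) (_↑_ Q a′ a′) (0F , a , a) (λ ())
      = -‿inverseʳ 0#

    reduce : (Idx size → Carrier) → Idx size → Carrier
    reduce coef (t , a , b) with comparable? Q a b | a ≟F b
    reduce coef (t  , a , b) | no _  | _     = 0#
    reduce coef (t  , a , b) | yes _ | no _  = coef (t , a , b)
    reduce coef (0F , a , b) | yes _ | yes _ = coef (0F , a , b) + coef (1F , a , b)
    reduce coef (1F , a , b) | yes _ | yes _ = 0#

    reduce-supported : ∀ coef → SupportedOn (Good Q) (reduce coef)
    reduce-supported coef (t , a , b) ¬good with comparable? Q a b | a ≟F b
    reduce-supported coef (t  , a , b) ¬good | no _    | _      = ≈-refl
    reduce-supported coef (0F , a , b) ¬good | yes cmp | _      = ⊥-elim (¬good cmp)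
    reduce-supported coef (1F , a , b) ¬good | yes cmp | no a≢b = ⊥-elim (¬good (cmp , a≢b))
    reduce-supported coef (1F , a , b) ¬good | yes _   | yes _  = ≈-refl

    reduce-pair : ∀ coef a b k →
      coef (0F , a , b) * relGen Q (0F , a , b) k + coef (1F , a , b) * relGen Q (1F , a , b) k ≈
      reduce coef (0F , a , b) * relGen Q (0F , a , b) k + reduce coef (1F , a , b) * relGen Q (1F , a , b) k
    reduce-pair coef a b k with comparable? Q a b | a ≟F b
    ... | no _  | _        = trans (+-cong (zeroʳ _) (zeroʳ _)) (sym (+-cong (zeroʳ _) (zeroʳ _)))
    ... | yes _ | no _     = ≈-refl
    ... | yes _ | yes refl rewrite ↑-idem Q a = begin
      c₀ * r + c₁ * r        ≈⟨ distribʳ r c₀ c₁ ⟨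
      (c₀ + c₁) * r          ≈⟨ +-identityʳ _ ⟨
      (c₀ + c₁) * r + 0#     ≈⟨ +-congˡ (zeroˡ r) ⟨
      (c₀ + c₁) * r + 0# * r ∎
      where
      c₀ c₁ r : Carrier
      c₀ = coef (0F , a , a)
      c₁ = coef (1F , a , a)
      r = basis 0F a a k - basis 1F a a k

    relGen-reduce : ∀ coef → ∃ λ coef′ → SupportedOn (Good Q) coef′ ×
                      (∀ k → lincombIdx coef (relGen Q) k ≈ lincombIdx coef′ (relGen Q) k)
    relGen-reduce coef = reduce coef , reduce-supported coef , λ k → begin
      lincombIdx coef (relGen Q) k
        ≈⟨ ΣIdx-pair (λ i → coef i * relGen Q i k) ⟩
      ΣK (λ a → ΣK λ b → coef (0F , a , b) * relGen Q (0F , a , b) k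
                       + coef (1F , a , b) * relGen Q (1F , a , b) k)
        ≈⟨ ΣK-cong (λ a → ΣK-cong λ b → reduce-pair coef a b k) ⟩
      ΣK (λ a → ΣK λ b → reduce coef (0F , a , b) * relGen Q (0F , a , b) k
                       + reduce coef (1F , a , b) * relGen Q (1F , a , b) k)
        ≈⟨ ΣIdx-pair (λ i → reduce coef i * relGen Q i k) ⟨
      lincombIdx (reduce coef) (relGen Q) k ∎

    module _ (coef : Idx size → Carrier) (supported : SupportedOn (Good Q) coef)
             (comb≈0 : ∀ k → lincombIdx coef (relGen Q) k ≈ 0#) where
      private
        isolated : ∀ i → (∀ j → j ≢ i → coef j * relGen Q j i ≈ 0#) → coef i * relGen Q i i ≈ 0#
        isolated i others = trans (sym (ΣIdx-single (λ j → coef j * relGen Q j i) i others)) (comb≈0 i)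

        offDiagonal : ∀ t {a b} → a ≢ b → coef (t , a , b) ≈ 0#
        offDiagonal t {a} {b} a≢b with comparable? Q a b
        ... | no ¬cmp = supported (t , a , b) (¬cmp ∘ good⇒comparable Q t)
        ... | yes cmp =
          cancel-sign t (trans (*-congˡ (sym (relGen-self t cmp))) (isolated (t , a , b) others))
          where
          others : ∀ j → j ≢ (t , a , b) → coef j * relGen Q j (t , a , b) ≈ 0#
          others j j≢ = trans (*-congˡ (relGen-offDiagonal j a≢b j≢)) (zeroʳ (coef j))

        diagonal : ∀ a → coef (0F , a , a) ≈ 0#
        diagonal a =
          cancel-sign 0F (trans (*-congˡ (sym (relGen-self 0F (inj₁ ≼-refl)))) (isolated (0F , a , a) others))
          where
          others : ∀ j → j ≢ (0F , a , a) → coef j * relGen Q j (0F , a , a) ≈ 0#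
          others (t′ , a′ , b′) j≢ with a′ ≟F b′
          ... | no a′≢b′ = trans (*-congʳ (offDiagonal t′ a′≢b′)) (zeroˡ _)
          others (0F , a′ , .a′) j≢ | yes refl =
            trans (*-congˡ (relGen-diagonal (j≢ ∘ cong (λ x → 0F , x , x)))) (zeroʳ _)
          others (1F , a′ , .a′) j≢ | yes refl =
            trans (*-congʳ (supported (1F , a′ , a′) λ (_ , a′≢a′) → a′≢a′ refl)) (zeroˡ _)

      relGen-independent : ∀ i → coef i ≈ 0#
      relGen-independent (t , a , b) with a ≟F b
      ... | no a≢b = offDiagonal t a≢b
      relGen-independent (0F , a , .a) | yes refl = diagonal a
      relGen-independent (1F , a , .a) | yes refl = supported (1F , a , a) λ (_ , a≢a) → a≢a refl

proposition2p4 : ∀ {c ℓ : Level} (K : CharZeroField c ℓ) (Q : FinPoset) →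
    LinAlg.HasDim K (LinAlg.RelSpace K Q) (4 ℕ.* int Q ∸ 3 ℕ.* FinPoset.size Q)
proposition2p4 K Q =
  ≡.subst (LinAlg.HasDim K (LinAlg.RelSpace K Q)) #good≡
    (hasDim-Span K (good? Q) (LinAlg.relGen K Q) (relGen-reduce K Q) (relGen-independent K Q))
  where
  #good≡ : sum³ (λ i → 𝟙 (good? Q i)) ≡ 4 ℕ.* int Q ∸ 3 ℕ.* FinPoset.size Q
  #good≡ = ≡.trans (≡.sym (ℕₚ.m+n∸n≡m _ (3 ℕ.* FinPoset.size Q)))
                   (cong (_∸ 3 ℕ.* FinPoset.size Q) (count-good Q))
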